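{- Let $T$ be a tree, let $\eta=(p_1,\dots,p_k)$ be a $k$-partition of $|\partial(T)|$, and let $\ell$ be an $\eta$-labeling of $\partial(T)$. Then for every edge $e\in E(T)$, at least four dipaths in $\mathcal{P}(T,\eta,\ell)$ cover $e$.
   Context: $\partial(T)$ is the set of leaves of $T$. A $k$-partition of $n$ is a $k$-tuple $(p_1,\dots,p_k)$ of integers with $p_i\ge 1$ and $\sum p_i=n$. The multidigraph $D_\eta$ has vertex set $\bigcup_{i=1}^k\{v^i_1,\dots,v^i_{p_i}\}$ and arcs as follows. If $k=1$: arcs $(v^1_i,v^1_{i+1})$ and $(v^1_{i+1},v^1_i)$ for each $i=1,\dots,n$, with $v^1_{n+1}=v^1_1$. If $k\ge 2$: (1) arcs $(v^i_j,v^i_{j+1})$ and $(v^i_{j+1},v^i_j)$ for all $1\le i\le k$, $1\le j\le p_i-1$; (2) arcs $(v^i_1,v^{i+1}_1)$ and $(v^i_{p_i},v^{i+1}_{p_{i+1}})$ for all $1\le i\le k$, where $v^{k+1}_1=v^1_1$ and $v^{k+1}_{p_{k+1}}=v^1_{p_1}$; arcs added in different steps are distinct even if they have the same tail and head. An $\eta$-labeling of $\partial(T)$ is a bijection $\ell:\partial(T)\to V(D_\eta)$. For distinct vertices $u,v$ of $T$, $\vec T[u,v]$ is the unique path of $T$ from $u$ to $v$ directed from $u$ to $v$. $\mathcal{P}(T,\eta,\ell)$ is the collection (counted with multiplicity, one member per arc) of the dipaths $\vec T[u,v]$ over all arcs $(\ell(u),\ell(v))$ of $D_\eta$, $u,v\in\partial(T)$.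 A dipath covers $e$ if $e$ lies on its underlying path. -}

module Defs where

open import Data.Nat using (ℕ; zero; suc; _≤_; _<_; _∸_)
open import Data.Nat.Properties using (≤-refl)
open import Data.Fin using (Fin; zero; suc; toℕ; fromℕ<; fromℕ)
open import Data.Bool using (Bool; true; false)
open import Data.List using (List; []; _∷_; length; filterᵇ; allFin; map)
open import Data.List.Relation.Unary.Unique.Propositional using (Unique)
open import Data.Product using (Σ; ∃; _×_; _,_; proj₁)
open import Data.Sum using (_⊎_)
open import Data.Empty using (⊥)
open import Relation.Nullary using (¬_; yes; no)
open import Relation.Binary.PropositionalEquality using (_≡_)
open import Function.Bundles using (Bijection; _⤖_)
open import Data.Nat.ListAction using (sum)

record Graph : Set where
  field
    m     : ℕ
    adj   : Fin m → Fin m → Bool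
    sym   : ∀ u v → adj u v ≡ adj v u
    irr   : ∀ u → adj u u ≡ false

module _ (G : Graph) where
  open Graph G

  data Walk : Fin m → Fin m → Set where
    [] : ∀ {u} → Walk u u
    step : ∀ {u w v} → adj u w ≡ true → Walk w v → Walk u v

  walkVertices : ∀ {u v} → Walk u v → List (Fin m)
  walkVertices {u} [] = u ∷ []
  walkVertices {u} (step _ w) = u ∷ walkVertices w

  walkLength : ∀ {u v} → Walk u v → ℕ
  walkLength [] = 0
  walkLength (step _ w) = suc (walkLength w)

  IsPath : ∀ {u v} → Walk u v → Set
  IsPath w = Unique (walkVertices w)

  UsesEdge : ∀ {u v} → Walk u v → Fin m → Fin m → Set
  UsesEdge [] a b = ⊥
  UsesEdge {u} (step {w = w} _ p) a b =
    ((u ≡ a × w ≡ b) ⊎ (u ≡ b × w ≡ a)) ⊎ UsesEdge p a b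

  Connected : Set
  Connected = ∀ u v → Walk u v

  HasCycle : Set
  HasCycle = Σ (Fin m) λ u → Σ (Fin m) λ w → Σ (Walk u w) λ p →
               IsPath p × 2 ≤ walkLength p × adj w u ≡ true

  IsTree : Set
  IsTree = Connected × ¬ HasCycle

  degree : Fin m → ℕ
  degree v = length (filterᵇ (adj v) (allFin m))

  IsLeaf : Fin m → Set
  IsLeaf v = degree v ≡ 1

  Leaves : Set
  Leaves = Σ (Fin m) IsLeaf

  isLeafᵇ : Fin m → Bool
  isLeafᵇ v with degree v Data.Nat.≟ 1
  ... | yes _ = true
  ... | no _ = false

  numLeaves : ℕ
  numLeaves = length (filterᵇ isLeafᵇ (allFin m))

  -- a dipath T[u,v] covers the edge {a,b}: the (unique) u–v path of T uses {a,b}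
  Covers : Fin m → Fin m → Fin m → Fin m → Set
  Covers u v a b = Σ (Walk u v) λ p → IsPath p × UsesEdge p a b

-- k-partitions η = (p_1,…,p_k) of n (indices 0..k-1 here)

record Partition (k n : ℕ) : Set where
  field
    p     : Fin k → ℕ
    pos   : ∀ i → 1 ≤ p i
    total : sum (map p (allFin k)) ≡ n

succMod : ∀ {n} → Fin n → Fin n
succMod {suc n} i with suc (toℕ i) Data.Nat.<? suc n
... | yes lt = fromℕ< lt
... | no _ = zero

firstF : (n : ℕ) → 1 ≤ n → Fin n
firstF (suc n) _ = zero

lastF : (n : ℕ) → 1 ≤ n → Fin n
lastF (suc n) _ = fromℕ n

module _ {k n : ℕ} (η : Partition k n) where
  open Partition η

  -- V(D_η) : v^i_j  ↦  (i , j)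
  Vtx : Set
  Vtx = Σ (Fin k) λ i → Fin (p i)

  v1 : Fin k → Vtx
  v1 i = i , firstF (p i) (pos i)

  vlast : Fin k → Vtx
  vlast i = i , lastF (p i) (pos i)

  -- arcs of D_η (distinct constructors/indices = distinct arcs)
  data Arc : Set where
    -- k = 1 (i is then the unique index): for each j, arcs (v_j , v_{j+1 mod p_1}) [true]
    -- and (v_{j+1 mod p_1} , v_j) [false]
    cyc  : k ≡ 1 → (i : Fin k) → Fin (p i) → Bool → Arc
    -- k ≥ 2, step (1): for j with j+1 < p_i (0-based), arcs (v^i_j, v^i_{j+1}) [true] and reverse [false]
    path : 2 ≤ k → (i : Fin k) → (j : Fin (p i)) → suc (toℕ j) < p i → Bool → Arc
    -- k ≥ 2, step (2): (v^i_1, v^{i+1}_1) [true] and (v^i_{p_i}, v^{i+1}_{p_{i+1}}) [false], i+1 mod k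
    link : 2 ≤ k → Fin k → Bool → Arc

  tail : Arc → Vtx
  tail (cyc _ i j true) = i , j
  tail (cyc _ i j false) = i , succMod j
  tail (path _ i j _ true) = i , j
  tail (path _ i j lt false) = i , fromℕ< lt
  tail (link _ i true) = v1 i
  tail (link _ i false) = vlast i

  head : Arc → Vtx
  head (cyc _ i j true) = i , succMod j
  head (cyc _ i j false) = i , j
  head (path _ i j lt true) = i , fromℕ< lt
  head (path _ i j _ false) = i , j
  head (link _ i true) = v1 (succMod i)
  head (link _ i false) = vlast (succMod i)

ArcCovers : (G : Graph) {k n : ℕ} (η : Partition k n) →
            Leaves G ⤖ Vtx η → Arc η →
            Fin (Graph.m G) → Fin (Graph.m G) → Set
ArcCovers G η ℓ α a b =
  Σ (Leaves G) λ u → Σ (Leaves G) λ v →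
    Bijection.to ℓ u ≡ tail η α × Bijection.to ℓ v ≡ head η α ×
    Covers G (proj₁ u) (proj₁ v) a b

{-# OPTIONS --safe #-}
-- Deleting the edge ab splits T into the vertices that reach a without using ab and those that
-- reach b. Each side contains a leaf (the far end of a maximal path starting with ab), and the
-- tree path between leaves on different sides uses ab; so colouring each vertex of D_η by the
-- side of its leaf gives a non-constant 2-colouring, and it suffices to find four arcs of D_η
-- joining the two colours. For k = 1, D_η is a doubled cycle, which changes colour at two places.
-- For k ≥ 2 the links form a cycle through the first vertices and one through the last vertices
-- of the rows, and each row is a doubled path: a non-constant link cycle gives two crossing
-- links, and a monochromatic one forces colour changes inside rows, each giving two opposite
-- crossing arcs.
module Submission where

open import Defs
open import Data.Nat as ℕ using (ℕ; zero; suc; _+_; _≤_; _<_; z≤n; s≤s)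
open import Data.Nat.Properties as ℕₚ using (m≤n+m; +-suc; +-identityʳ; <⇒≱; <-irrefl; <⇒≢; <-≤-trans)
open import Data.Fin as Fin using (Fin; zero; suc; _≟_; toℕ; fromℕ; fromℕ<)
open import Data.Fin.Properties using (injective⇒≤; suc-injective; 0≢1+n; any?; all?; ¬∀⟶∃¬; toℕ-fromℕ; toℕ-injective; ≤fromℕ; ≤∧≢⇒<)
open import Data.Bool as Bool using (Bool; true; false)
open import Data.Bool.Properties using (¬-not)
open import Data.List using (List; []; _∷_; length; lookup; filterᵇ; tabulate)
open import Data.List.Membership.Propositional using (_∈_; _∉_)
open import Data.List.Membership.Propositional.Properties using (∈-lookup)
open import Data.List.Relation.Unary.All as All using (All)
open import Data.List.Relation.Unary.All.Properties using (¬Any⇒All¬; anti-mono)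
open import Data.List.Relation.Unary.AllPairs using ([]; _∷_)
open import Data.List.Relation.Unary.Any using (here; there)
open import Data.List.Relation.Binary.Subset.Propositional using (_⊆_)
open import Data.List.Relation.Unary.Unique.Propositional using (Unique)
open import Data.Vec as Vec using (Vec; []; _∷_)
open import Data.Vec.Relation.Unary.All using ([]; _∷_) renaming (All to Allᵛ)
open import Data.Vec.Relation.Unary.All.Properties using (lookup⁺)
open import Data.Vec.Relation.Unary.AllPairs using ([]; _∷_)
open import Data.Vec.Relation.Unary.Unique.Propositional using () renaming (Unique to Uniqueᵛ)
open import Data.Vec.Relation.Unary.Unique.Propositional.Properties using () renaming (lookup-injective to lookup-injectiveᵛ)
open import Data.Product using (Σ; _×_; _,_; proj₁; proj₂)
open import Data.Sum as Sum using (_⊎_; inj₁; inj₂; [_,_]′)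
open import Data.Empty using (⊥; ⊥-elim)
open import Function using (_∘_; id)
open import Function.Definitions using (Injective)
open import Function.Bundles using (_⤖_; Inverse)
open import Function.Properties.Bijection using (⤖⇒↔)
open import Relation.Nullary using (¬_; Dec; yes; no; contradiction)
open import Relation.Nullary.Decidable using (_×-dec_; _⊎-dec_; ¬?; decidable-stable)
open import Relation.Binary.PropositionalEquality using (_≡_; _≢_; refl; sym; trans; cong; subst)

lookup-injective : {A : Set} {xs : List A} → Unique xs → Injective _≡_ _≡_ (lookup xs)
lookup-injective {xs = _ ∷ _} _               {zero}  {zero}  _  = refl
lookup-injective {xs = _ ∷ _} (x∉xs ∷ _)      {zero}  {suc j} eq = contradiction eq (All.lookup x∉xs (∈-lookup j))
lookup-injective {xs = _ ∷ _} (x∉xs ∷ _)      {suc i} {zero}  eq = contradiction (sym eq) (All.lookup x∉xs (∈-lookup i))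
lookup-injective {xs = _ ∷ _} (_ ∷ xs-unique) {suc i} {suc j} eq = cong suc (lookup-injective xs-unique eq)

Unique⇒length≤ : ∀ {m} {xs : List (Fin m)} → Unique xs → length xs ≤ m
Unique⇒length≤ xs-unique = injective⇒≤ (lookup-injective xs-unique)

filterᵇ-tabulate-none : ∀ {A : Set} {n} (g : Fin n → A) (P : A → Bool) →
                        (∀ i → P (g i) ≡ false) → filterᵇ P (tabulate g) ≡ []
filterᵇ-tabulate-none {n = zero}  g P none = refl
filterᵇ-tabulate-none {n = suc n} g P none rewrite none zero = filterᵇ-tabulate-none (g ∘ suc) P (none ∘ suc)

length-filterᵇ-tabulate-single : ∀ {A : Set} {n} (g : Fin n → A) (P : A → Bool) (s : Fin n) →
                                 P (g s) ≡ true → (∀ i → P (g i) ≡ true → i ≡ s) →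
                                 length (filterᵇ P (tabulate g)) ≡ 1
length-filterᵇ-tabulate-single {n = suc n} g P zero Ps only rewrite Ps =
  cong (suc ∘ length) (filterᵇ-tabulate-none (g ∘ suc) P λ i → ¬-not (0≢1+n ∘ sym ∘ only (suc i)))
length-filterᵇ-tabulate-single {n = suc n} g P (suc s) Ps only
  rewrite ¬-not {P (g zero)} (0≢1+n ∘ only zero) =
  length-filterᵇ-tabulate-single (g ∘ suc) P s Ps (λ i → suc-injective ∘ only (suc i))

LeavesAt : ∀ {N} (g : Fin N → Bool) (β : Bool) (j : Fin N) → Set
LeavesAt {N} g β j = Σ (suc (toℕ j) < N) λ j+1<N → g j ≡ β × g (fromℕ< j+1<N) ≢ β

ChangesAt : ∀ {N} (g : Fin N → Bool) (j : Fin N) → Set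
ChangesAt {N} g j = Σ (suc (toℕ j) < N) λ j+1<N → g j ≢ g (fromℕ< j+1<N)

leavesBetween : ∀ {N} (g : Fin N → Bool) {β} (x y : Fin N) → x Fin.< y → g x ≡ β → g y ≢ β →
                Σ (Fin N) λ j → x Fin.≤ j × j Fin.< y × LeavesAt g β j
leavesBetween g zero (suc zero) _ gx gy = zero , z≤n , s≤s z≤n , s≤s (s≤s z≤n) , gx , gy
-- The recursive call sits in the with-head so that the termination checker sees it is structural.
leavesBetween g {β} zero (suc (suc y)) _ gx gy
  with g (suc zero) Bool.≟ β | leavesBetween (g ∘ suc) zero (suc y) (s≤s z≤n)
... | no  g1≢β | _     = zero , z≤n , s≤s z≤n , s≤s (s≤s z≤n) , gx , g1≢β
... | yes g1≡β | later with later g1≡β gy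
...   | j , _ , j<y , j+1<N , gj , gj+1 = suc j , z≤n , s≤s j<y , s≤s j+1<N , gj , gj+1
leavesBetween g (suc x) (suc y) (s≤s x<y) gx gy with leavesBetween (g ∘ suc) x y x<y gx gy
... | j , x≤j , j<y , j+1<N , gj , gj+1 = suc j , s≤s x≤j , s≤s j<y , s≤s j+1<N , gj , gj+1

changeBetween : ∀ {N} (g : Fin N → Bool) {x y : Fin N} → x Fin.< y → g x ≢ g y →
                Σ (Fin N) λ j → x Fin.≤ j × j Fin.< y × ChangesAt g j
changeBetween g x<y gx≢gy =
  let j , x≤j , j<y , j+1<N , gj , gj+1 = leavesBetween g _ _ x<y refl (gx≢gy ∘ sym)
  in j , x≤j , j<y , j+1<N , λ e → gj+1 (trans (sym e) gj)

succMod-fromℕ< : ∀ {N} (j : Fin N) (j+1<N : suc (toℕ j) < N) → succMod j ≡ fromℕ< j+1<N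
succMod-fromℕ< {suc N} j j+1<N with suc (toℕ j) ℕ.<? suc N
... | yes _     = refl
... | no  j+1≮N = contradiction j+1<N j+1≮N

succMod-fromℕ : ∀ n → succMod (fromℕ n) ≡ zero
succMod-fromℕ n with suc (toℕ (fromℕ n)) ℕ.<? suc n
... | yes n+1<n+1 = contradiction (subst (λ i → suc i < suc n) (toℕ-fromℕ n) n+1<n+1) (<-irrefl refl)
... | no  _       = refl

LeavesAt⇒succMod : ∀ {N} (g : Fin N → Bool) {β j} → LeavesAt g β j → g j ≡ β × g (succMod j) ≢ β
LeavesAt⇒succMod g {β} {j} (j+1<N , gj , gj+1) = gj , subst (λ i → g i ≢ β) (sym (succMod-fromℕ< j j+1<N)) gj+1

leavesCyclically : ∀ {N} (g : Fin N → Bool) {β} {t f : Fin N} → g t ≡ β → g f ≢ β →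
                   Σ (Fin N) λ j → g j ≡ β × g (succMod j) ≢ β
leavesCyclically {suc n} g {β} {t} {f} gt gf with g (fromℕ n) Bool.≟ β | g zero Bool.≟ β
... | yes glast | no g0  = fromℕ n , glast , subst (λ i → g i ≢ β) (sym (succMod-fromℕ n)) g0
... | yes _     | yes g0 =
  let j , _ , _ , leaves = leavesBetween g zero f 0<f g0 gf in j , LeavesAt⇒succMod g leaves
  where
  0<f : Fin.zero {n} Fin.< f
  0<f = ≤∧≢⇒< z≤n λ 0≡f → gf (subst (λ i → g i ≡ β) 0≡f g0)
... | no glast  | _      =
  let j , _ , _ , leaves = leavesBetween g t (fromℕ n) t<last gt glast in j , LeavesAt⇒succMod g leaves
  where
  t<last : t Fin.< fromℕ n
  t<last = ≤∧≢⇒< (≤fromℕ t) λ t≡last → glast (subst (λ i → g i ≡ β) t≡last gt)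

twoCyclicChanges : ∀ {N} (g : Fin N → Bool) {t f : Fin N} → g t ≢ g f →
                   Σ (Fin N) λ j₁ → Σ (Fin N) λ j₂ →
                     j₁ ≢ j₂ × g j₁ ≢ g (succMod j₁) × g j₂ ≢ g (succMod j₂)
twoCyclicChanges g gt≢gf with leavesCyclically g refl (gt≢gf ∘ sym) | leavesCyclically g refl gt≢gf
... | j₁ , gj₁ , gj₁+1 | j₂ , gj₂ , gj₂+1 =
  j₁ , j₂ , (λ { refl → gt≢gf (trans (sym gj₁) gj₂) }) ,
  (λ e → gj₁+1 (trans (sym e) gj₁)) , (λ e → gj₂+1 (trans (sym e) gj₂))

constantOrChanges : ∀ {N} (g : Fin N → Bool) (r : Fin N) → (∀ i → g i ≡ g r) ⊎ Σ (Fin N) λ i → g i ≢ g r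
constantOrChanges {N} g r with all? (λ i → g i Bool.≟ g r)
... | yes constant = inj₁ constant
... | no  ¬constant = inj₂ (¬∀⟶∃¬ N _ (λ i → g i Bool.≟ g r) ¬constant)

firstF< : ∀ N (1≤N : 1 ≤ N) (j : Fin N) → j ≢ firstF N 1≤N → firstF N 1≤N Fin.< j
firstF< (suc N) _ zero    j≢first = contradiction refl j≢first
firstF< (suc N) _ (suc j) _       = s≤s z≤n

<lastF : ∀ N (1≤N : 1 ≤ N) (j : Fin N) → j ≢ lastF N 1≤N → j Fin.< lastF N 1≤N
<lastF (suc N) _ j j≢last = ≤∧≢⇒< (≤fromℕ j) j≢last

two-distinct : ∀ {k} → 2 ≤ k → Σ (Fin k) λ r₀ → Σ (Fin k) λ r₁ → r₀ ≢ r₁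
two-distinct (s≤s (s≤s _)) = zero , suc zero , λ ()

Fin-unique : ∀ {k} → k ≡ 1 → (i j : Fin k) → i ≡ j
Fin-unique refl zero zero = refl

module WalkProperties (G : Graph) where
  open Graph G renaming (sym to adj-sym)
  open import Data.List.Membership.DecPropositional (_≟_ {m}) using (_∈?_)

  adj-flip : ∀ {u v} → adj u v ≡ true → adj v u ≡ true
  adj-flip {u} {v} uv = trans (adj-sym v u) uv

  adj⇒≢ : ∀ {u v} → adj u v ≡ true → u ≢ v
  adj⇒≢ {u} uv refl = contradiction (trans (sym uv) (irr u)) λ ()

  _++ʷ_ : ∀ {u v w} → Walk G u v → Walk G v w → Walk G u w
  []        ++ʷ q = q
  step uw p ++ʷ q = step uw (p ++ʷ q)

  reverseʷ : ∀ {u v} → Walk G u v → Walk G v u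
  reverseʷ []          = []
  reverseʷ (step uw p) = reverseʷ p ++ʷ step (adj-flip uw) []

  UsesEdge-++⁻ : ∀ {u v w a b} (p : Walk G u v) (q : Walk G v w) →
                 UsesEdge G (p ++ʷ q) a b → UsesEdge G p a b ⊎ UsesEdge G q a b
  UsesEdge-++⁻ []         q uses         = inj₂ uses
  UsesEdge-++⁻ (step _ p) q (inj₁ first) = inj₁ (inj₁ first)
  UsesEdge-++⁻ (step _ p) q (inj₂ uses)  = Sum.map₁ inj₂ (UsesEdge-++⁻ p q uses)

  UsesEdge-reverse⁻ : ∀ {u v a b} (p : Walk G u v) → UsesEdge G (reverseʷ p) a b → UsesEdge G p a b
  UsesEdge-reverse⁻ (step _ p) uses with UsesEdge-++⁻ (reverseʷ p) _ uses
  ... | inj₁ in-p                   = inj₂ (UsesEdge-reverse⁻ p in-p)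
  ... | inj₂ (inj₁ (inj₁ (e , e′))) = inj₁ (inj₂ (e′ , e))
  ... | inj₂ (inj₁ (inj₂ (e , e′))) = inj₁ (inj₁ (e′ , e))

  UsesEdge-flip : ∀ {u v a b} (p : Walk G u v) → UsesEdge G p a b → UsesEdge G p b a
  UsesEdge-flip (step _ p) (inj₁ (inj₁ e)) = inj₁ (inj₂ e)
  UsesEdge-flip (step _ p) (inj₁ (inj₂ e)) = inj₁ (inj₁ e)
  UsesEdge-flip (step _ p) (inj₂ uses)     = inj₂ (UsesEdge-flip p uses)

  usesEdge? : ∀ {u v} (p : Walk G u v) a b → Dec (UsesEdge G p a b)
  usesEdge? []                 a b = no λ ()
  usesEdge? (step {u} {w} _ p) a b =
    ((u ≟ a ×-dec w ≟ b) ⊎-dec (u ≟ b ×-dec w ≟ a)) ⊎-dec usesEdge? p a b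

  _⊆ᴱ_ : ∀ {u v u′ v′} → Walk G u v → Walk G u′ v′ → Set
  p ⊆ᴱ q = ∀ {a b} → UsesEdge G p a b → UsesEdge G q a b

  dropUntil : ∀ {u v x} (p : Walk G u v) → IsPath G p → x ∈ walkVertices G p →
              Σ (Walk G x v) λ q → IsPath G q × q ⊆ᴱ p
  dropUntil []          p-path (here refl) = [] , p-path , id
  dropUntil (step uw p) p-path (here refl) = step uw p , p-path , id
  dropUntil (step uw p) (_ ∷ p-path) (there x∈p) =
    let q , q-path , q⊆p = dropUntil p p-path x∈p in q , q-path , inj₂ ∘ q⊆p

  takeUntil : ∀ {u v x} (p : Walk G u v) → IsPath G p → x ∈ walkVertices G p →
              Σ (Walk G u x) λ q → IsPath G q × walkVertices G q ⊆ walkVertices G p ×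
                                   (x ≢ u → 1 ≤ walkLength G q)
  takeUntil []          p-path (here refl) = [] , p-path , id , λ x≢x → contradiction refl x≢x
  takeUntil (step uw p) p-path (here refl) = [] , All.[] ∷ [] , (λ { (here refl) → here refl }) ,
                                             λ x≢x → contradiction refl x≢x
  takeUntil (step uw p) (u∉p ∷ p-path) (there x∈p) =
    let q , q-path , q⊆p , _ = takeUntil p p-path x∈p
    in step uw q , anti-mono q⊆p u∉p ∷ q-path , (λ { (here e) → here e ; (there y∈q) → there (q⊆p y∈q) }) ,
       λ _ → s≤s z≤n

  toPath : ∀ {u v} (p : Walk G u v) → Σ (Walk G u v) λ q → IsPath G q × q ⊆ᴱ p
  toPath []              = [] , All.[] ∷ [] , id
  toPath (step {u} uw p) with toPath p
  ... | q , q-path , q⊆p with u ∈? walkVertices G q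
  ...   | yes u∈q = let r , r-path , r⊆q = dropUntil q q-path u∈q in r , r-path , inj₂ ∘ q⊆p ∘ r⊆q
  ...   | no  u∉q = step uw q , ¬Any⇒All¬ _ u∉q ∷ q-path , Sum.map₂ q⊆p

  acyclic⇒path-uses-edge : ¬ HasCycle G → ∀ {x y} → adj x y ≡ true →
                           (p : Walk G x y) → IsPath G p → UsesEdge G p x y
  acyclic⇒path-uses-edge _ xy [] _ = contradiction refl (adj⇒≢ xy)
  acyclic⇒path-uses-edge _ xy (step _ []) _ = inj₁ (inj₁ (refl , refl))
  acyclic⇒path-uses-edge acyclic {x} {y} xy p@(step _ (step _ _)) p-path =
    ⊥-elim (acyclic (x , y , p , p-path , s≤s (s≤s z≤n) , adj-flip xy))

  acyclic⇒chordless : ¬ HasCycle G → ∀ {w s t y} (ws : adj w s ≡ true) (p : Walk G s t) →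
                      IsPath G (step ws p) → adj w y ≡ true → y ∈ walkVertices G p → y ≡ s
  acyclic⇒chordless acyclic {w} {s} {y = y} ws p (w∉p ∷ p-path) wy y∈p with y ≟ s
  ... | yes y≡s = y≡s
  ... | no  y≢s =
    let q , q-path , q⊆p , q-long = takeUntil p p-path y∈p
    in ⊥-elim (acyclic (w , y , step ws q , anti-mono q⊆p w∉p ∷ q-path , s≤s (q-long y≢s) , adj-flip wy))

module EdgeSides (T : Graph) (tree : IsTree T) {a b : Fin (Graph.m T)} (ab : Graph.adj T a b ≡ true) where
  open Graph T using (m; adj)
  open WalkProperties T
  open import Data.List.Membership.DecPropositional (_≟_ {m}) using (_∈?_)

  connected : Connected T
  connected = proj₁ tree

  acyclic : ¬ HasCycle T
  acyclic = proj₂ tree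

  Avoids : ∀ {u v} → Walk T u v → Set
  Avoids p = ¬ UsesEdge T p a b

  Reaches : Fin m → Fin m → Set
  Reaches t x = Σ (Walk T x t) Avoids

  Reaches-++ : ∀ {t u v} (r : Walk T u v) → Avoids r → Reaches t v → Reaches t u
  Reaches-++ r r-avoids (p , p-avoids) = r ++ʷ p , [ r-avoids , p-avoids ]′ ∘ UsesEdge-++⁻ r p

  ¬Reaches-b-from-a : ¬ Reaches b a
  ¬Reaches-b-from-a (p , p-avoids) =
    let q , q-path , q⊆p = toPath p in p-avoids (q⊆p (acyclic⇒path-uses-edge acyclic ab q q-path))

  ¬Reaches-both : ∀ {x} → Reaches a x → Reaches b x → ⊥
  ¬Reaches-both (p , p-avoids) x⇝b =
    ¬Reaches-b-from-a (Reaches-++ (reverseʷ p) (p-avoids ∘ UsesEdge-reverse⁻ p) x⇝b)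

  reachesEndpoint : ∀ {u v} (p : Walk T u v) → UsesEdge T p a b → Reaches a u ⊎ Reaches b u
  reachesEndpoint (step {u} uw p) uses with u ≟ a | u ≟ b
  ... | yes refl | _        = inj₁ ([] , λ ())
  ... | no _     | yes refl = inj₂ ([] , λ ())
  ... | no u≢a   | no u≢b   =
    Sum.map (Reaches-++ (step uw []) uw-avoids) (Reaches-++ (step uw []) uw-avoids) (reachesEndpoint p later)
    where
    uw-avoids : Avoids (step uw [])
    uw-avoids (inj₁ (inj₁ (u≡a , _))) = u≢a u≡a
    uw-avoids (inj₁ (inj₂ (u≡b , _))) = u≢b u≡b
    later : UsesEdge T p a b
    later = Sum.[ ⊥-elim ∘ uw-avoids ∘ inj₁ , id ]′ uses

  side : ∀ x → Reaches a x ⊎ Reaches b x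
  side x with usesEdge? (connected x a) a b
  ... | no  avoids = inj₁ (connected x a , avoids)
  ... | yes uses   = reachesEndpoint (connected x a) uses

  onSideA : Fin m → Bool
  onSideA x = [ (λ _ → true) , (λ _ → false) ]′ (side x)

  Reaches-a⇒onSideA : ∀ {x} → Reaches a x → onSideA x ≡ true
  Reaches-a⇒onSideA {x} x⇝a with side x
  ... | inj₁ _   = refl
  ... | inj₂ x⇝b = ⊥-elim (¬Reaches-both x⇝a x⇝b)

  Reaches-b⇒¬onSideA : ∀ {x} → Reaches b x → onSideA x ≡ false
  Reaches-b⇒¬onSideA {x} x⇝b with side x
  ... | inj₁ x⇝a = ⊥-elim (¬Reaches-both x⇝a x⇝b)
  ... | inj₂ _   = refl

  differentSides⇒Covers : ∀ u v → onSideA u ≢ onSideA v → Covers T u v a b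
  differentSides⇒Covers u v differ with toPath (connected u v)
  ... | r , r-path , _ with usesEdge? r a b
  ...   | yes uses   = r , r-path , uses
  ...   | no  avoids = contradiction (sameSide (side v)) differ
    where
    sameSide : Reaches a v ⊎ Reaches b v → onSideA u ≡ onSideA v
    sameSide (inj₁ v⇝a) = trans (Reaches-a⇒onSideA (Reaches-++ r avoids v⇝a)) (sym (Reaches-a⇒onSideA v⇝a))
    sameSide (inj₂ v⇝b) = trans (Reaches-b⇒¬onSideA (Reaches-++ r avoids v⇝b)) (sym (Reaches-b⇒¬onSideA v⇝b))

  record PathThrough-a : Set where
    field
      start next : Fin m
      first-edge : adj start next ≡ true
      rest       : Walk T next b
      isPath     : IsPath T (step first-edge rest)
      a∈         : a ∈ walkVertices T (step first-edge rest)
      b∈         : b ∈ walkVertices T (step first-edge rest)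
      start⇝a    : Reaches a start

    vertices : List (Fin m)
    vertices = walkVertices T (step first-edge rest)

    Maximal : Set
    Maximal = ∀ x → adj start x ≡ true → x ∈ vertices

    extend : ∀ x → adj start x ≡ true → x ∉ vertices → PathThrough-a
    extend x sx x∉ = record
      { start = x ; next = start ; first-edge = adj-flip sx ; rest = step first-edge rest
      ; isPath = ¬Any⇒All¬ _ x∉ ∷ isPath ; a∈ = there a∈ ; b∈ = there b∈
      ; start⇝a = Reaches-++ (step (adj-flip sx) []) xs-avoids start⇝a }
      where
      xs-avoids : Avoids (step (adj-flip sx) [])
      xs-avoids (inj₁ (inj₁ (x≡a , _))) = x∉ (subst (_∈ vertices) (sym x≡a) a∈)
      xs-avoids (inj₁ (inj₂ (x≡b , _))) = x∉ (subst (_∈ vertices) (sym x≡b) b∈)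

    extendable? : (Σ (Fin m) λ x → adj start x ≡ true × x ∉ vertices) ⊎ Maximal
    extendable? with any? (λ x → (adj start x Bool.≟ true) ×-dec ¬? (x ∈? vertices))
    ... | yes extension = inj₁ extension
    ... | no  stuck     = inj₂ λ x sx → decidable-stable (x ∈? vertices) λ x∉ → stuck (x , sx , x∉)

    maximal⇒leaf : Maximal → IsLeaf T start
    maximal⇒leaf maximal = length-filterᵇ-tabulate-single id (adj start) next first-edge only-next
      where
      only-next : ∀ y → adj start y ≡ true → y ≡ next
      only-next y sy with maximal y sy
      ... | here y≡start  = contradiction (sym y≡start) (adj⇒≢ sy)
      ... | there y∈rest = acyclic⇒chordless acyclic first-edge rest isPath sy y∈rest

  open PathThrough-a

  edge-ab : PathThrough-a
  edge-ab = record
    { start = a ; next = b ; first-edge = ab ; rest = [] ; isPath = (adj⇒≢ ab All.∷ All.[]) ∷ All.[] ∷ []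
    ; a∈ = here refl ; b∈ = there (here refl) ; start⇝a = [] , λ () }

  maximalPath : ∀ fuel (P : PathThrough-a) → m ≤ length (vertices P) + fuel → Σ PathThrough-a Maximal
  maximalPath fuel P bound with extendable? P | fuel
  ... | inj₂ maximal        | _          = P , maximal
  ... | inj₁ (x , sx , x∉) | zero       =
    contradiction (subst (m ≤_) (+-identityʳ _) bound) (<⇒≱ (Unique⇒length≤ (isPath (extend P x sx x∉))))
  ... | inj₁ (x , sx , x∉) | suc fuel′ =
    maximalPath fuel′ (extend P x sx x∉) (subst (m ≤_) (+-suc _ fuel′) bound)

  leafReaching-a : Σ (Leaves T) λ x → Reaches a (proj₁ x)
  leafReaching-a =
    let P , maximal = maximalPath m edge-ab (m≤n+m m 2)
    in (start P , maximal⇒leaf P maximal) , start⇝a P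

module Crossings {k n : ℕ} (η : Partition k n) (c : Vtx η → Bool) where
  open Partition η

  Crossing : Arc η → Set
  Crossing α = c (tail η α) ≢ c (head η α)

  FourCrossingArcs : Set
  FourCrossingArcs = Σ (Fin 4 → Arc η) λ f → Injective _≡_ _≡_ f × (∀ i → Crossing (f i))

  record CrossingPair : Set where
    constructor crossingPair
    field
      fst snd      : Arc η
      fst≢snd      : fst ≢ snd
      fst-crossing : Crossing fst
      snd-crossing : Crossing snd
  open CrossingPair

  pairs⇒fourCrossingArcs : ∀ {D : Set} (d : Arc η → D) (P Q : CrossingPair) →
                           d (fst P) ≡ d (snd P) → d (fst Q) ≡ d (snd Q) → d (fst P) ≢ d (fst Q) →
                           FourCrossingArcs
  pairs⇒fourCrossingArcs d P Q dP dQ dP≢dQ =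
    Vec.lookup arcs , (λ {i} {j} → lookup-injectiveᵛ arcs-unique i j) , lookup⁺ arcs-crossing
    where
    arcs : Vec (Arc η) 4
    arcs = fst P ∷ snd P ∷ fst Q ∷ snd Q ∷ []
    apart : ∀ {α β} → d α ≡ d (fst P) → d β ≡ d (fst Q) → α ≢ β
    apart dα dβ α≡β = dP≢dQ (trans (sym dα) (trans (cong d α≡β) dβ))
    arcs-unique : Uniqueᵛ arcs
    arcs-unique = (fst≢snd P ∷ apart refl refl ∷ apart refl (sym dQ) ∷ [])
                ∷ (apart (sym dP) refl ∷ apart (sym dP) (sym dQ) ∷ [])
                ∷ (fst≢snd Q ∷ []) ∷ [] ∷ []
    arcs-crossing : Allᵛ Crossing arcs
    arcs-crossing = fst-crossing P ∷ snd-crossing P ∷ fst-crossing Q ∷ snd-crossing Q ∷ []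

  orientation : Arc η → Bool
  orientation (cyc _ _ _ β)    = β
  orientation (path _ _ _ _ β) = β
  orientation (link _ _ β)     = β

  row : Arc η → Fin k
  row (cyc _ i _ _)    = i
  row (path _ i _ _ _) = i
  row (link _ i _)     = i

  column : Arc η → ℕ
  column (cyc _ _ j _)    = toℕ j
  column (path _ _ j _ _) = toℕ j
  column (link _ _ _)     = 0  -- dummy: link arcs are never told apart by column

  isLink : Arc η → Bool
  isLink (link _ _ _) = true
  isLink _            = false

  cyclePair : (k≡1 : k ≡ 1) (i : Fin k) (j : Fin (p i)) → c (i , j) ≢ c (i , succMod j) → CrossingPair
  cyclePair k≡1 i j change = crossingPair (cyc k≡1 i j true) (cyc k≡1 i j false) (λ ()) change (change ∘ sym)

  rowPair : (2≤k : 2 ≤ k) (i : Fin k) (j : Fin (p i)) → ChangesAt (λ j → c (i , j)) j → CrossingPair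
  rowPair 2≤k i j (j+1<pᵢ , change) =
    crossingPair (path 2≤k i j j+1<pᵢ true) (path 2≤k i j j+1<pᵢ false) (λ ()) change (change ∘ sym)

  linkEnd : Bool → Fin k → Vtx η
  linkEnd true  = v1 η
  linkEnd false = vlast η

  link-crossing : (2≤k : 2 ≤ k) (β : Bool) (i : Fin k) →
                  c (linkEnd β i) ≢ c (linkEnd β (succMod i)) → Crossing (link 2≤k i β)
  link-crossing _ true  _ = id
  link-crossing _ false _ = id

  linkPair : (2≤k : 2 ≤ k) (β : Bool) {i r : Fin k} → c (linkEnd β i) ≢ c (linkEnd β r) → CrossingPair
  linkPair 2≤k β differ =
    let j₁ , j₂ , j₁≢j₂ , change₁ , change₂ = twoCyclicChanges (c ∘ linkEnd β) differ
    in crossingPair (link 2≤k j₁ β) (link 2≤k j₂ β) (j₁≢j₂ ∘ cong row)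
                    (link-crossing 2≤k β j₁ change₁) (link-crossing 2≤k β j₂ change₂)

  changeAfterFirst : (i : Fin k) {j : Fin (p i)} → c (v1 η i) ≢ c (i , j) →
                     Σ (Fin (p i)) λ J → J Fin.< j × ChangesAt (λ j → c (i , j)) J
  changeAfterFirst i {j} differ =
    let J , _ , J<j , change = changeBetween (λ j → c (i , j))
                                 (firstF< (p i) (pos i) j λ j≡first → differ (cong (λ j → c (i , j)) (sym j≡first)))
                                 differ
    in J , J<j , change

  changeBeforeLast : (i : Fin k) {j : Fin (p i)} → c (i , j) ≢ c (vlast η i) →
                     Σ (Fin (p i)) λ J → j Fin.≤ J × ChangesAt (λ j → c (i , j)) J
  changeBeforeLast i {j} differ =
    let J , j≤J , _ , change = changeBetween (λ j → c (i , j))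
                                 (<lastF (p i) (pos i) j λ j≡last → differ (cong (λ j → c (i , j)) j≡last))
                                 differ
    in J , j≤J , change

  someVertexNot : {x y : Vtx η} → c x ≢ c y → ∀ C → Σ (Vtx η) λ z → c z ≢ C
  someVertexNot {x} {y} cx≢cy C with c x Bool.≟ C
  ... | yes cx≡C = y , λ cy≡C → cx≢cy (trans cx≡C (sym cy≡C))
  ... | no  cx≢C = x , cx≢C

  fourCrossingArcs-k≡1 : k ≡ 1 → {x y : Vtx η} → c x ≢ c y → FourCrossingArcs
  fourCrossingArcs-k≡1 k≡1 {i , _} {i′ , _} differ with Fin-unique k≡1 i i′
  ... | refl =
    let j₁ , j₂ , j₁≢j₂ , change₁ , change₂ = twoCyclicChanges (λ j → c (i , j)) differ
    in pairs⇒fourCrossingArcs column (cyclePair k≡1 i j₁ change₁) (cyclePair k≡1 i j₂ change₂)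
                        refl refl (j₁≢j₂ ∘ toℕ-injective)

  fourCrossingArcs-2≤k : 2 ≤ k → {x y : Vtx η} → c x ≢ c y → FourCrossingArcs
  fourCrossingArcs-2≤k 2≤k {r , _} differ
    with constantOrChanges (c ∘ v1 η) r | constantOrChanges (c ∘ vlast η) r
  ... | inj₂ (_ , firsts-change) | inj₂ (_ , lasts-change) =
    pairs⇒fourCrossingArcs orientation (linkPair 2≤k true firsts-change) (linkPair 2≤k false lasts-change)
                     refl refl λ ()
  ... | inj₁ firsts-const | inj₂ (_ , lasts-change) =
    let (i , _) , odd = someVertexNot differ (c (v1 η r))
        J , _ , change = changeAfterFirst i (λ e → odd (trans (sym e) (firsts-const i)))
    in pairs⇒fourCrossingArcs isLink (rowPair 2≤k i J change) (linkPair 2≤k false lasts-change) refl refl λ ()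
  ... | inj₂ (_ , firsts-change) | inj₁ lasts-const =
    let (i , _) , odd = someVertexNot differ (c (vlast η r))
        J , _ , change = changeBeforeLast i (λ e → odd (trans e (lasts-const i)))
    in pairs⇒fourCrossingArcs isLink (rowPair 2≤k i J change) (linkPair 2≤k true firsts-change) refl refl λ ()
  ... | inj₁ firsts-const | inj₁ lasts-const with c (v1 η r) Bool.≟ c (vlast η r)
  ...   | yes same =
    let (i , _) , odd = someVertexNot differ (c (v1 η r))
        J₁ , J₁<j , change₁ = changeAfterFirst i (λ e → odd (trans (sym e) (firsts-const i)))
        J₂ , j≤J₂ , change₂ = changeBeforeLast i (λ e → odd (trans e (trans (lasts-const i) (sym same))))
    in pairs⇒fourCrossingArcs column (rowPair 2≤k i J₁ change₁) (rowPair 2≤k i J₂ change₂)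
                        refl refl (<⇒≢ (<-≤-trans J₁<j j≤J₂))
  ...   | no ends-differ =
    let r₀ , r₁ , r₀≢r₁ = two-distinct 2≤k
        J₀ , _ , change₀ = changeBeforeLast r₀ (ends-differ-in r₀)
        J₁ , _ , change₁ = changeBeforeLast r₁ (ends-differ-in r₁)
    in pairs⇒fourCrossingArcs row (rowPair 2≤k r₀ J₀ change₀) (rowPair 2≤k r₁ J₁ change₁) refl refl r₀≢r₁
    where
    ends-differ-in : ∀ i → c (v1 η i) ≢ c (vlast η i)
    ends-differ-in i e = ends-differ (trans (sym (firsts-const i)) (trans e (lasts-const i)))

  nonconstant⇒fourCrossingArcs : 1 ≤ k → {x y : Vtx η} → c x ≢ c y → FourCrossingArcs
  nonconstant⇒fourCrossingArcs 1≤k differ with k ℕ.≟ 1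
  ... | yes k≡1 = fourCrossingArcs-k≡1 k≡1 differ
  ... | no  k≢1 = fourCrossingArcs-2≤k (ℕₚ.≤∧≢⇒< 1≤k (k≢1 ∘ sym)) differ

leafReaching-b : (T : Graph) (tree : IsTree T) {a b : Fin (Graph.m T)} (ab : Graph.adj T a b ≡ true) →
                 Σ (Leaves T) λ x → EdgeSides.Reaches T tree ab b (proj₁ x)
leafReaching-b T tree ab =
  let x , p , p-avoids = EdgeSides.leafReaching-a T tree (adj-flip ab)
  in x , p , p-avoids ∘ UsesEdge-flip p
  where open WalkProperties T

lemma8 : (T : Graph) → IsTree T →
         (k : ℕ) → 1 ≤ k → (η : Partition k (numLeaves T)) →
         (ℓ : Leaves T ⤖ Vtx η) →
         (a b : Fin (Graph.m T)) → Graph.adj T a b ≡ true →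
         Σ (Fin 4 → Arc η) λ f →
           Injective _≡_ _≡_ f × (∀ i → ArcCovers T η ℓ (f i) a b)
lemma8 T tree k 1≤k η ℓ a b ab =
  let f , f-injective , f-crossing = nonconstant⇒fourCrossingArcs 1≤k leaves-differ
  in f , f-injective , λ i → crossing⇒covers (f i) (f-crossing i)
  where
  open EdgeSides T tree ab
  open Inverse (⤖⇒↔ ℓ)
  colour : Vtx η → Bool
  colour = onSideA ∘ proj₁ ∘ from
  open Crossings η colour
  leafA : Σ (Leaves T) λ x → Reaches a (proj₁ x)
  leafA = leafReaching-a
  leafB : Σ (Leaves T) λ x → Reaches b (proj₁ x)
  leafB = leafReaching-b T tree ab
  leaves-differ : colour (to (proj₁ leafA)) ≢ colour (to (proj₁ leafB))
  leaves-differ rewrite strictlyInverseʳ (proj₁ leafA) | strictlyInverseʳ (proj₁ leafB)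
    | Reaches-a⇒onSideA (proj₂ leafA) | Reaches-b⇒¬onSideA (proj₂ leafB) = λ ()
  crossing⇒covers : ∀ α → Crossing α → ArcCovers T η ℓ α a b
  crossing⇒covers α crossing = from (tail η α) , from (head η α) ,
    strictlyInverseˡ (tail η α) , strictlyInverseˡ (head η α) , differentSides⇒Covers _ _ crossing
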